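{- Let $v\in\mathbb{Z}^3$ be a nonzero integer vector. Then there exist $w_1,w_2\in\mathbb{Z}^3$ such that $v,w_1,w_2$ is an orthoregular system (an integral orthoregular basis of $\mathbb{R}^3$) if and only if the Euclidean norm $|v|$ is an integer. In particular, $E_{\mathbb{Z}}(3,1)=3$.
   Context: A system $v_1,\ldots,v_k$ of vectors in $\mathbb{R}^n$ is called orthoregular if (i) $v_i\perp v_j$ (standard inner product) for $i\neq j$, and (ii) $|v_i|=|v_j|\neq 0$ for all $i,j$ ($|\cdot|$ the Euclidean norm); the common value $|v_i|$ is the length of the system. For an orthoregular system $S\subset\mathbb{Z}^n$, $E(S)$ denotes the maximum number of vectors in an orthoregular system of integer vectors in $\mathbb{Z}^n$ containing $S$. For an integer $0<k<n$ and $K\subseteq\mathbb{R}$, $E_K(n,k)$ denotes the minimum of $E(S)$ over all orthoregular systems $S\subset\mathbb{Z}^n$ with $k$ elements whose length lies in $K$. -}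

module Defs where

open import Data.Nat using (ℕ; _≤_)
open import Data.Integer using (ℤ; +_; _+_; _*_; 0ℤ)
open import Data.Fin using (Fin; zero; suc)
open import Data.Vec using (Vec; _∷_; []; lookup)
import Data.Vec
open import Data.Product using (Σ; _×_; ∃; ∃-syntax)
open import Relation.Binary.PropositionalEquality using (_≡_; _≢_)

Vecℤ : ℕ → Set
Vecℤ n = Vec ℤ n

dot : ∀ {n} → Vecℤ n → Vecℤ n → ℤ
dot [] [] = 0ℤ
dot (x ∷ xs) (y ∷ ys) = x * y + dot xs ys

normSq : ∀ {n} → Vecℤ n → ℤ
normSq v = dot v v

System : ℕ → ℕ → Set
System n k = Fin k → Vecℤ n

-- orthoregular: pairwise orthogonal, all of equal nonzero length
-- (equal lengths ⇔ equal squared lengths, since lengths are ≥ 0)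
Orthoregular : ∀ {n k} → System n k → Set
Orthoregular {n} {k} S =
  (∀ (i j : Fin k) → i ≢ j → dot (S i) (S j) ≡ 0ℤ)
  × (∀ (i j : Fin k) → normSq (S i) ≡ normSq (S j))
  × (∀ (i : Fin k) → normSq (S i) ≢ 0ℤ)

-- the Euclidean norm |v| = √(normSq v) is an integer
-- (as |v| ≥ 0, this means normSq v = m² for some natural m)
NormIsInteger : ∀ {n} → Vecℤ n → Set
NormIsInteger v = ∃[ m ] normSq v ≡ (+ m) * (+ m)

-- the length of a (nonempty) system lies in ℤ
-- (for an orthoregular system all lengths agree; we require each to be an integer)
LengthInℤ : ∀ {n k} → System n k → Set
LengthInℤ {k = k} S = ∀ (i : Fin k) → NormIsInteger (S i)

Contains : ∀ {n k e} → System n e → System n k → Set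
Contains {k = k} {e = e} T S = ∀ (i : Fin k) → ∃[ j ] T j ≡ S i

ExtendsTo : ∀ {n k} → System n k → ℕ → Set
ExtendsTo {n} S e = ∃[ T ] (Orthoregular {n} {e} T × Contains T S)

IsE : ∀ {n k} → System n k → ℕ → Set
IsE S e = ExtendsTo S e × (∀ e′ → ExtendsTo S e′ → e′ ≤ e)

IsEℤ : ℕ → ℕ → ℕ → Set
IsEℤ n k e =
  (∃[ S ] (Orthoregular {n} {k} S × LengthInℤ S × IsE S e))
  × (∀ (S : System n k) → Orthoregular S → LengthInℤ S →
       ∀ e′ → IsE S e′ → e ≤ e′)

triple : ∀ {n} → Vecℤ n → Vecℤ n → Vecℤ n → System n 3
triple u v w zero = u
triple u v w (suc zero) = v
triple u v w (suc (suc zero)) = w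

zeroVec : ∀ n → Vecℤ n
zeroVec n = Data.Vec.replicate n 0ℤ

-- If v, w₁, w₂ is orthoregular of squared length l, the triple product D = (v × w₁) · w₂ satisfies
-- D² = l³ (the cross product of two orthogonal vectors of squared length l is parallel to the third
-- and has squared length l²), and l³ being a square forces l to be a square.
--
-- Conversely let |v|² = a² + b² + c² = d². Then c² + b² = (d + a)(d − a), and a descent in the
-- Gaussian integers splits this as p = d + a = g|α|², q = d − a = g|β|², c + ib = g α β̄. For the
-- quaternion q = α + β j the rows of the matrix of v ↦ q v q̄ are pairwise orthogonal of squared
-- length |q|⁴, and g times the first row is 2v. If g is even this gives v directly; otherwise |q|²
-- is even, q = (1 + u) q′ for a unit u ∈ {i, j, k}, and the first row is twice a row of q′.
--
-- Finally ℤ³ holds no four pairwise orthogonal nonzero vectors: the last two would both be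
-- parallel to the cross product of the first two and orthogonal to each other.

module Submission where

open import Defs
open import Data.Empty using (⊥-elim)
open import Data.Fin using (Fin; zero; suc)
open import Data.Integer.Base as ℤ using (ℤ; +_; -[1+_]; _+_; _*_; _-_; -_; 0ℤ; 1ℤ; ∣_∣)
import Data.Integer.Properties as ℤ
import Data.Integer.DivMod as ℤ
open import Data.Integer.Divisibility.Signed
  using (_∣_; divides; ∣-refl; ∣⇒∣ᵤ; ∣m∣n⇒∣m+n; ∣m∣n⇒∣m-n; ∣m+n∣m⇒∣n; ∣m⇒∣m*n)
open import Data.Integer.Tactic.RingSolver using (solve; solve-∀)
import Data.List as List
open import Data.Nat.Base as ℕ using (ℕ; zero; suc; z≤n; s≤s)
import Data.Nat.Properties as ℕ
import Data.Nat.Divisibility as ℕ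
import Data.Nat.DivMod as ℕ
import Data.Nat.Tactic.RingSolver as ℕ-Solver
open import Data.Nat.Coprimality using (coprime-/gcd; coprime-divisor)
open import Data.Nat.GCD using (gcd; gcd[m,n]∣m; gcd[m,n]∣n; gcd[m,n]≢0)
open import Data.Nat.Induction using (<-wellFounded)
open import Data.Product using (_×_; _,_; proj₁; proj₂; ∃-syntax)
open import Data.Sum as Sum using (_⊎_; inj₁; inj₂; reduce)
open import Data.Vec as Vec using (_∷_; [])
open import Function using (_∘_)
open import Function.Bundles using (_⇔_; mk⇔)
open import Induction.WellFounded using (Acc; acc)
open import Relation.Binary.PropositionalEquality
  using (_≡_; _≢_; refl; sym; trans; cong; cong₂; subst; subst₂; module ≡-Reasoning)
open import Relation.Nullary using (¬_; yes; no)

open ≡-Reasoning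

pattern ⟨_,_,_⟩ a b c = a ∷ b ∷ c ∷ []

⟨,,⟩-cong : ∀ {a b c a′ b′ c′ : ℤ} → a ≡ a′ → b ≡ b′ → c ≡ c′ → ⟨ a , b , c ⟩ ≡ ⟨ a′ , b′ , c′ ⟩
⟨,,⟩-cong refl refl refl = refl

infix 4 _⟂_
_⟂_ : ∀ {n} → Vecℤ n → Vecℤ n → Set
u ⟂ v = dot u v ≡ 0ℤ

infixr 7 _*ₗ_
_*ₗ_ : ∀ {n} → ℤ → Vecℤ n → Vecℤ n
k *ₗ v = Vec.map (k *_) v

dot-comm : ∀ {n} (u v : Vecℤ n) → dot u v ≡ dot v u
dot-comm []      []      = refl
dot-comm (x ∷ u) (y ∷ v) = cong₂ _+_ (ℤ.*-comm x y) (dot-comm u v)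

dot-*ₗ : ∀ {n} k l (u v : Vecℤ n) → dot (k *ₗ u) (l *ₗ v) ≡ k * l * dot u v
dot-*ₗ k l []      []      = sym (ℤ.*-zeroʳ (k * l))
dot-*ₗ k l (x ∷ u) (y ∷ v) =
  trans (cong (λ d → k * x * (l * y) + d) (dot-*ₗ k l u v)) (factor k l x y (dot u v))
  where
  factor : ∀ k l x y d → k * x * (l * y) + k * l * d ≡ k * l * (x * y + d)
  factor = solve-∀

dot-zeroVecˡ : ∀ {n} (v : Vecℤ n) → dot (zeroVec n) v ≡ 0ℤ
dot-zeroVecˡ []      = refl
dot-zeroVecˡ (x ∷ v) = trans (ℤ.+-identityˡ _) (dot-zeroVecˡ v)

*ₗ-assoc : ∀ {n} k l (v : Vecℤ n) → (k * l) *ₗ v ≡ k *ₗ l *ₗ v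
*ₗ-assoc k l []      = refl
*ₗ-assoc k l (x ∷ v) = cong₂ _∷_ (ℤ.*-assoc k l x) (*ₗ-assoc k l v)

*ₗ-comm : ∀ {n} k l (v : Vecℤ n) → k *ₗ l *ₗ v ≡ l *ₗ k *ₗ v
*ₗ-comm k l v = begin
  k *ₗ l *ₗ v   ≡⟨ *ₗ-assoc k l v ⟨
  (k * l) *ₗ v  ≡⟨ cong (_*ₗ v) (ℤ.*-comm k l) ⟩
  (l * k) *ₗ v  ≡⟨ *ₗ-assoc l k v ⟩
  l *ₗ k *ₗ v   ∎

*ₗ-cancelˡ : ∀ {n} k .{{_ : ℤ.NonZero k}} (u v : Vecℤ n) → k *ₗ u ≡ k *ₗ v → u ≡ v
*ₗ-cancelˡ k []      []      _  = refl
*ₗ-cancelˡ k (x ∷ u) (y ∷ v) eq =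
  cong₂ _∷_ (ℤ.*-cancelˡ-≡ k x y (cong Vec.head eq)) (*ₗ-cancelˡ k u v (cong Vec.tail eq))

normSqℕ : ∀ {n} → Vecℤ n → ℕ
normSqℕ []      = 0
normSqℕ (x ∷ v) = ∣ x ∣ ℕ.* ∣ x ∣ ℕ.+ normSqℕ v

i*i≡+∣i∣*∣i∣ : ∀ i → i * i ≡ + (∣ i ∣ ℕ.* ∣ i ∣)
i*i≡+∣i∣*∣i∣ (+ n)    = sym (ℤ.pos-* n n)
i*i≡+∣i∣*∣i∣ -[1+ n ] = refl

normSq≡+normSqℕ : ∀ {n} (v : Vecℤ n) → normSq v ≡ + normSqℕ v
normSq≡+normSqℕ []      = refl
normSq≡+normSqℕ (x ∷ v) = cong₂ _+_ (i*i≡+∣i∣*∣i∣ x) (normSq≡+normSqℕ v)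

normSqℕ≡0⇒≡zeroVec : ∀ {n} (v : Vecℤ n) → normSqℕ v ≡ 0 → v ≡ zeroVec n
normSqℕ≡0⇒≡zeroVec []      _  = refl
normSqℕ≡0⇒≡zeroVec (x ∷ v) eq = cong₂ _∷_
  (ℤ.∣i∣≡0⇒i≡0 (reduce (ℕ.m*n≡0⇒m≡0∨n≡0 ∣ x ∣ (ℕ.m+n≡0⇒m≡0 _ eq))))
  (normSqℕ≡0⇒≡zeroVec v (ℕ.m+n≡0⇒n≡0 _ eq))

normSq≡0⇒≡zeroVec : ∀ {n} (v : Vecℤ n) → normSq v ≡ 0ℤ → v ≡ zeroVec n
normSq≡0⇒≡zeroVec v eq =
  normSqℕ≡0⇒≡zeroVec v (ℤ.+-injective (trans (sym (normSq≡+normSqℕ v)) eq))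

record WeakOrthoregular {n} (u v w : Vecℤ n) : Set where
  field
    u⟂v : u ⟂ v
    u⟂w : u ⟂ w
    v⟂w : v ⟂ w
    ∣v∣≡∣u∣ : normSq v ≡ normSq u
    ∣w∣≡∣u∣ : normSq w ≡ normSq u

module _ {n} {u v w : Vecℤ n} (W : WeakOrthoregular u v w) where
  open WeakOrthoregular W

  weakOrthoregular-swap₁₂ : WeakOrthoregular v u w
  weakOrthoregular-swap₁₂ = record
    { u⟂v = trans (dot-comm v u) u⟂v ; u⟂w = v⟂w ; v⟂w = u⟂w
    ; ∣v∣≡∣u∣ = sym ∣v∣≡∣u∣ ; ∣w∣≡∣u∣ = trans ∣w∣≡∣u∣ (sym ∣v∣≡∣u∣) }

  weakOrthoregular-swap₂₃ : WeakOrthoregular u w v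
  weakOrthoregular-swap₂₃ = record
    { u⟂v = u⟂w ; u⟂w = u⟂v ; v⟂w = trans (dot-comm w v) v⟂w
    ; ∣v∣≡∣u∣ = ∣w∣≡∣u∣ ; ∣w∣≡∣u∣ = ∣v∣≡∣u∣ }

  weakOrthoregular-*ₗ : ∀ k → WeakOrthoregular (k *ₗ u) (k *ₗ v) (k *ₗ w)
  weakOrthoregular-*ₗ k = record
    { u⟂v = scaled-⟂ u v u⟂v ; u⟂w = scaled-⟂ u w u⟂w ; v⟂w = scaled-⟂ v w v⟂w
    ; ∣v∣≡∣u∣ = scaled-norm v ∣v∣≡∣u∣ ; ∣w∣≡∣u∣ = scaled-norm w ∣w∣≡∣u∣ }
    where
    scaled-⟂ : ∀ (s t : Vecℤ n) → s ⟂ t → k *ₗ s ⟂ k *ₗ t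
    scaled-⟂ s t s⟂t = trans (dot-*ₗ k k s t) (trans (cong (k * k *_) s⟂t) (ℤ.*-zeroʳ (k * k)))
    scaled-norm : ∀ (s : Vecℤ n) → normSq s ≡ normSq u → normSq (k *ₗ s) ≡ normSq (k *ₗ u)
    scaled-norm s eq = trans (dot-*ₗ k k s s) (trans (cong (k * k *_) eq) (sym (dot-*ₗ k k u u)))

  weakOrthoregular⇒orthoregular : normSq u ≢ 0ℤ → Orthoregular (triple u v w)
  weakOrthoregular⇒orthoregular ∣u∣≢0 =
    orthogonal , (λ i j → trans (norm i) (sym (norm j))) , (λ i → ∣u∣≢0 ∘ trans (sym (norm i)))
    where
    orthogonal : ∀ i j → i ≢ j → triple u v w i ⟂ triple u v w j
    orthogonal zero             zero             i≢j = ⊥-elim (i≢j refl)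
    orthogonal zero             (suc zero)       _   = u⟂v
    orthogonal zero             (suc (suc zero)) _   = u⟂w
    orthogonal (suc zero)       zero             _   = trans (dot-comm v u) u⟂v
    orthogonal (suc zero)       (suc zero)       i≢j = ⊥-elim (i≢j refl)
    orthogonal (suc zero)       (suc (suc zero)) _   = v⟂w
    orthogonal (suc (suc zero)) zero             _   = trans (dot-comm w u) u⟂w
    orthogonal (suc (suc zero)) (suc zero)       _   = trans (dot-comm w v) v⟂w
    orthogonal (suc (suc zero)) (suc (suc zero)) i≢j = ⊥-elim (i≢j refl)
    norm : ∀ i → normSq (triple u v w i) ≡ normSq u
    norm zero             = refl
    norm (suc zero)       = ∣v∣≡∣u∣
    norm (suc (suc zero)) = ∣w∣≡∣u∣

single-orthoregular : ∀ {n} (v : Vecℤ n) → normSq v ≢ 0ℤ → Orthoregular {k = 1} (λ _ → v)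
single-orthoregular v ∣v∣≢0 = (λ { zero zero 0≢0 → ⊥-elim (0≢0 refl) }) , (λ _ _ → refl) , (λ _ → ∣v∣≢0)

Completion : Vecℤ 3 → Set
Completion v = ∃[ w₁ ] ∃[ w₂ ] WeakOrthoregular v w₁ w₂

completion-*ₗ : ∀ k {v} → Completion v → Completion (k *ₗ v)
completion-*ₗ k (w₁ , w₂ , W) = k *ₗ w₁ , k *ₗ w₂ , weakOrthoregular-*ₗ W k

-- The cross product

cross : Vecℤ 3 → Vecℤ 3 → Vecℤ 3
cross ⟨ a , b , c ⟩ ⟨ d , e , f ⟩ = ⟨ b * f - c * e , c * d - a * f , a * e - b * d ⟩

binet-cauchy : ∀ s t u v → dot (cross s t) (cross u v) ≡ dot s u * dot t v - dot s v * dot t u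
binet-cauchy ⟨ a , b , c ⟩ ⟨ d , e , f ⟩ ⟨ g , h , i ⟩ ⟨ j , k , l ⟩ = identity a b c d e f g h i j k l
  where
  identity : ∀ a b c d e f g h i j k l →
    (b * f - c * e) * (h * l - i * k) + ((c * d - a * f) * (i * j - g * l) + ((a * e - b * d) * (g * k - h * j) + 0ℤ))
      ≡ (a * g + (b * h + (c * i + 0ℤ))) * (d * j + (e * k + (f * l + 0ℤ)))
        - (a * j + (b * k + (c * l + 0ℤ))) * (d * g + (e * h + (f * i + 0ℤ)))
  identity = solve-∀

combination≡0 : ∀ {r m n : ℤ} s t → r ≡ m * s - n * t → m ≡ 0ℤ → n ≡ 0ℤ → r ≡ 0ℤ
combination≡0 s t eq refl refl = eq

-- (u × v) × w = (u · w) v − (v · w) u, coordinatewise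
⟂⟂⇒cross-cross≡0 : ∀ u v w → u ⟂ w → v ⟂ w → cross (cross u v) w ≡ zeroVec 3
⟂⟂⇒cross-cross≡0 ⟨ a , b , c ⟩ ⟨ d , e , f ⟩ ⟨ g , h , i ⟩ u⟂w v⟂w = ⟨,,⟩-cong
  (combination≡0 d a (first a b c d e f g h i) u⟂w v⟂w)
  (combination≡0 e b (second a b c d e f g h i) u⟂w v⟂w)
  (combination≡0 f c (third a b c d e f g h i) u⟂w v⟂w)
  where
  first : ∀ a b c d e f g h i → (c * d - a * f) * i - (a * e - b * d) * h
    ≡ (a * g + (b * h + (c * i + 0ℤ))) * d - (d * g + (e * h + (f * i + 0ℤ))) * a
  first = solve-∀
  second : ∀ a b c d e f g h i → (a * e - b * d) * g - (b * f - c * e) * i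
    ≡ (a * g + (b * h + (c * i + 0ℤ))) * e - (d * g + (e * h + (f * i + 0ℤ))) * b
  second = solve-∀
  third : ∀ a b c d e f g h i → (b * f - c * e) * h - (c * d - a * f) * g
    ≡ (a * g + (b * h + (c * i + 0ℤ))) * f - (d * g + (e * h + (f * i + 0ℤ))) * c
  third = solve-∀

normSq-cross : ∀ u v → u ⟂ v → normSq (cross u v) ≡ normSq u * normSq v
normSq-cross u v u⟂v = begin
  normSq (cross u v)                        ≡⟨ binet-cauchy u v u v ⟩
  normSq u * normSq v - dot u v * dot v u   ≡⟨ cong (λ x → normSq u * normSq v - x * dot v u) u⟂v ⟩
  normSq u * normSq v - 0ℤ * dot v u        ≡⟨ ℤ.+-identityʳ (normSq u * normSq v) ⟩
  normSq u * normSq v                       ∎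

cross≡0⇒dot²≡normSq*normSq : ∀ u v → cross u v ≡ zeroVec 3 → dot u v * dot u v ≡ normSq u * normSq v
cross≡0⇒dot²≡normSq*normSq u v u×v≡0 = sym (ℤ.i-j≡0⇒i≡j _ _ (begin
  normSq u * normSq v - dot u v * dot u v  ≡⟨ cong (λ x → normSq u * normSq v - dot u v * x) (dot-comm u v) ⟩
  normSq u * normSq v - dot u v * dot v u  ≡⟨ binet-cauchy u v u v ⟨
  normSq (cross u v)                       ≡⟨ cong normSq u×v≡0 ⟩
  0ℤ                                       ∎))

triple-product² : ∀ u v w → u ⟂ v → u ⟂ w → v ⟂ w →
  dot (cross u v) w * dot (cross u v) w ≡ normSq u * normSq v * normSq w
triple-product² u v w u⟂v u⟂w v⟂w = begin
  dot (cross u v) w * dot (cross u v) w  ≡⟨ cross≡0⇒dot²≡normSq*normSq (cross u v) w (⟂⟂⇒cross-cross≡0 u v w u⟂w v⟂w) ⟩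
  normSq (cross u v) * normSq w          ≡⟨ cong (_* normSq w) (normSq-cross u v u⟂v) ⟩
  normSq u * normSq v * normSq w         ∎

four-orthogonal : ∀ t₀ t₁ t₂ t₃ → t₀ ⟂ t₁ → t₀ ⟂ t₂ → t₀ ⟂ t₃ → t₁ ⟂ t₂ → t₁ ⟂ t₃ → t₂ ⟂ t₃ →
  normSq t₀ * normSq t₁ * normSq t₂ ≡ 0ℤ ⊎ normSq t₀ * normSq t₁ * normSq t₃ ≡ 0ℤ
four-orthogonal t₀ t₁ t₂ t₃ t₀⟂t₁ t₀⟂t₂ t₀⟂t₃ t₁⟂t₂ t₁⟂t₃ t₂⟂t₃ =
  Sum.swap (Sum.map (degenerate t₃ t₀⟂t₃ t₁⟂t₃) (degenerate t₂ t₀⟂t₂ t₁⟂t₂ ∘ trans (dot-comm c t₂))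
                    (ℤ.i*j≡0⇒i≡0∨j≡0 (dot c t₃) c·t₃*t₂·c≡0))
  where
  c = cross t₀ t₁
  degenerate : ∀ t → t₀ ⟂ t → t₁ ⟂ t → dot c t ≡ 0ℤ → normSq t₀ * normSq t₁ * normSq t ≡ 0ℤ
  degenerate t t₀⟂t t₁⟂t c·t≡0 = trans (sym (triple-product² t₀ t₁ t t₀⟂t₁ t₀⟂t t₁⟂t)) (cong (λ x → x * x) c·t≡0)
  -- c × t₂ = 0, so Binet–Cauchy for (c × t₂) · (c × t₃) leaves (c · t₃)(t₂ · c) = |c|² (t₂ · t₃) = 0
  c·t₃*t₂·c≡0 : dot c t₃ * dot t₂ c ≡ 0ℤ
  c·t₃*t₂·c≡0 = sym (ℤ.i-j≡0⇒i≡j 0ℤ _ (begin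
    0ℤ - dot c t₃ * dot t₂ c                     ≡⟨ cong (λ x → x - dot c t₃ * dot t₂ c) (ℤ.*-zeroʳ (normSq c)) ⟨
    normSq c * 0ℤ - dot c t₃ * dot t₂ c          ≡⟨ cong (λ x → normSq c * x - dot c t₃ * dot t₂ c) t₂⟂t₃ ⟨
    normSq c * dot t₂ t₃ - dot c t₃ * dot t₂ c   ≡⟨ binet-cauchy c t₂ c t₃ ⟨
    dot (cross c t₂) (cross c t₃)                ≡⟨ cong (λ x → dot x (cross c t₃)) (⟂⟂⇒cross-cross≡0 t₀ t₁ t₂ t₀⟂t₂ t₁⟂t₂) ⟩
    dot (zeroVec 3) (cross c t₃)                 ≡⟨ dot-zeroVecˡ (cross c t₃) ⟩
    0ℤ                                           ∎))

m*m≤n*n⇒m≤n : ∀ {m n} → m ℕ.* m ℕ.≤ n ℕ.* n → m ℕ.≤ n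
m*m≤n*n⇒m≤n {m} {n} m²≤n² with m ℕ.≤? n
... | yes m≤n = m≤n
... | no  m≰n = ⊥-elim (ℕ.<⇒≱ (ℕ.*-mono-< (ℕ.≰⇒> m≰n) (ℕ.≰⇒> m≰n)) m²≤n²)

2*m≤n⇒m<n : ∀ {m n} .{{_ : ℕ.NonZero n}} → 2 ℕ.* m ℕ.≤ n → m ℕ.< n
2*m≤n⇒m<n {zero}  {suc _} _    = s≤s z≤n
2*m≤n⇒m<n {suc m}         2m≤n = ℕ.<-≤-trans (ℕ.m<m+n (suc m) (s≤s z≤n)) 2m≤n

m*m∣n*n⇒m∣n : ∀ {m n} → m ≢ 0 → m ℕ.* m ℕ.∣ n ℕ.* n → m ℕ.∣ n
m*m∣n*n⇒m∣n {m} {n} m≢0 m²∣n² = subst (ℕ._∣ n) g≡m (gcd[m,n]∣n m n)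
  where
  g = gcd m n
  instance
    g≢0 : ℕ.NonZero g
    g≢0 = ℕ.≢-nonZero (gcd[m,n]≢0 m n (inj₁ m≢0))
    g²≢0 : ℕ.NonZero (g ℕ.* g)
    g²≢0 = ℕ.m*n≢0 g g
  -- m = m′ g and n = n′ g with m′ and n′ coprime; m′² ∣ n′² then forces m′ = 1
  square : ∀ {k} → g ℕ.∣ k → k ℕ.* k ≡ (k ℕ./ g) ℕ.* (k ℕ./ g) ℕ.* (g ℕ.* g)
  square {k} g∣k = trans (cong (λ x → x ℕ.* x) (sym (ℕ.m/n*n≡m g∣k))) (ℕ.[m*n]*[o*p]≡[m*o]*[n*p] (k ℕ./ g) g (k ℕ./ g) g)

  m′ = m ℕ./ g
  m′∣n′*n′ : m′ ℕ.∣ (n ℕ./ g) ℕ.* (n ℕ./ g)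
  m′∣n′*n′ = ℕ.∣-trans (ℕ.m∣m*n m′) (ℕ.*-cancelʳ-∣ (g ℕ.* g)
    (subst₂ ℕ._∣_ (square (gcd[m,n]∣m m n)) (square (gcd[m,n]∣n m n)) m²∣n²))
  m′≡1 : m′ ≡ 1
  m′≡1 = coprime-/gcd m n (ℕ.∣-refl , coprime-divisor (coprime-/gcd m n) m′∣n′*n′)
  g≡m : g ≡ m
  g≡m = trans (sym (ℕ.*-identityˡ g)) (trans (cong (ℕ._* g) (sym m′≡1)) (ℕ.m/n*n≡m (gcd[m,n]∣m m n)))

cube≡square⇒square : ∀ {l d} → l ≢ 0 → d ℕ.* d ≡ l ℕ.* l ℕ.* l → ∃[ m ] l ≡ m ℕ.* m
cube≡square⇒square {l} {d} l≢0 d²≡l³ =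
  root (m*m∣n*n⇒m∣n l≢0 (ℕ.divides l (trans d²≡l³ (ℕ.*-comm (l ℕ.* l) l))))
  where
  instance
    l²≢0 : ℕ.NonZero (l ℕ.* l)
    l²≢0 = ℕ.m*n≢0 l l {{ℕ.≢-nonZero l≢0}} {{ℕ.≢-nonZero l≢0}}
  root : l ℕ.∣ d → ∃[ m ] l ≡ m ℕ.* m
  root (ℕ.divides m d≡ml) = m , sym (ℕ.*-cancelʳ-≡ (m ℕ.* m) l (l ℕ.* l) (begin
    m ℕ.* m ℕ.* (l ℕ.* l)  ≡⟨ ℕ.[m*n]*[o*p]≡[m*o]*[n*p] m l m l ⟨
    m ℕ.* l ℕ.* (m ℕ.* l)  ≡⟨ cong (λ x → x ℕ.* x) d≡ml ⟨
    d ℕ.* d                ≡⟨ d²≡l³ ⟩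
    l ℕ.* l ℕ.* l          ≡⟨ ℕ.*-comm (l ℕ.* l) l ⟩
    l ℕ.* (l ℕ.* l)        ∎))

-- Necessity of an integral length, and E ≤ 3

cube≡0⇒≡0 : ∀ i → i * i * i ≡ 0ℤ → i ≡ 0ℤ
cube≡0⇒≡0 i i³≡0 with ℤ.i*j≡0⇒i≡0∨j≡0 (i * i) i³≡0
... | inj₁ i²≡0 = reduce (ℤ.i*j≡0⇒i≡0∨j≡0 i i²≡0)
... | inj₂ i≡0  = i≡0

orthoregular-size≤3 : ∀ {e} (T : System 3 e) → Orthoregular T → e ℕ.≤ 3
orthoregular-size≤3 {0} _ _ = z≤n
orthoregular-size≤3 {1} _ _ = s≤s z≤n
orthoregular-size≤3 {2} _ _ = s≤s (s≤s z≤n)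
orthoregular-size≤3 {3} _ _ = s≤s (s≤s (s≤s z≤n))
orthoregular-size≤3 {suc (suc (suc (suc k)))} T (⟂ , ∣∣≡ , ∣∣≢0) = ⊥-elim (∣∣≢0 i₀ (cube≡0⇒≡0 L
  (reduce (Sum.map (cube i₂) (cube i₃) (four-orthogonal (T i₀) (T i₁) (T i₂) (T i₃)
    (⟂ i₀ i₁ (λ ())) (⟂ i₀ i₂ (λ ())) (⟂ i₀ i₃ (λ ())) (⟂ i₁ i₂ (λ ())) (⟂ i₁ i₃ (λ ())) (⟂ i₂ i₃ (λ ())))))))
  where
  i₀ i₁ i₂ i₃ : Fin (suc (suc (suc (suc k))))
  i₀ = zero
  i₁ = suc zero
  i₂ = suc (suc zero)
  i₃ = suc (suc (suc zero))
  L = normSq (T i₀)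
  cube : ∀ i → L * normSq (T i₁) * normSq (T i) ≡ 0ℤ → L * L * L ≡ 0ℤ
  cube i = trans (cong₂ (λ s t → L * s * t) (sym (∣∣≡ i₁ i₀)) (sym (∣∣≡ i i₀)))

orthoregular-triple⇒normIsInteger : ∀ v w₁ w₂ → Orthoregular (triple v w₁ w₂) → NormIsInteger v
orthoregular-triple⇒normIsInteger v w₁ w₂ (⟂ , ∣∣≡ , ∣∣≢0) =
  square-norm (cube≡square⇒square {d = ∣ D ∣} l≢0 ∣D∣²≡l³)
  where
  l = normSqℕ v
  D = dot (cross v w₁) w₂
  l≢0 : l ≢ 0
  l≢0 l≡0 = ∣∣≢0 zero (trans (normSq≡+normSqℕ v) (cong +_ l≡0))
  D²≡L³ : D * D ≡ normSq v * normSq v * normSq v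
  D²≡L³ = trans
    (triple-product² v w₁ w₂
      (⟂ zero (suc zero) (λ ())) (⟂ zero (suc (suc zero)) (λ ())) (⟂ (suc zero) (suc (suc zero)) (λ ())))
    (cong₂ (λ s t → normSq v * s * t) (∣∣≡ (suc zero) zero) (∣∣≡ (suc (suc zero)) zero))
  ∣D∣²≡l³ : ∣ D ∣ ℕ.* ∣ D ∣ ≡ l ℕ.* l ℕ.* l
  ∣D∣²≡l³ = ℤ.+-injective (begin
    + (∣ D ∣ ℕ.* ∣ D ∣)             ≡⟨ i*i≡+∣i∣*∣i∣ D ⟨
    D * D                           ≡⟨ D²≡L³ ⟩
    normSq v * normSq v * normSq v  ≡⟨ cong (λ x → x * x * x) (normSq≡+normSqℕ v) ⟩
    + l * + l * + l                 ≡⟨ cong (λ x → x * + l) (ℤ.pos-* l l) ⟨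
    + (l ℕ.* l) * + l               ≡⟨ ℤ.pos-* (l ℕ.* l) l ⟨
    + (l ℕ.* l ℕ.* l)               ∎)
  square-norm : ∃[ m ] l ≡ m ℕ.* m → NormIsInteger v
  square-norm (m , l≡m²) = m , trans (normSq≡+normSqℕ v) (trans (cong +_ l≡m²) (ℤ.pos-* m m))

Even : ℤ → Set
Even i = + 2 ∣ i

even-or-odd : ∀ i → Even i ⊎ Even (i + 1ℤ)
even-or-odd i = parity (i ℤ.%ℕ 2) (i ℤ./ℕ 2) (ℤ.n%ℕd<d i 2) (ℤ.a≡a%ℕn+[a/ℕn]*n i 2)
  where
  parity : ∀ r q → r ℕ.< 2 → i ≡ + r + q * + 2 → Even i ⊎ Even (i + 1ℤ)
  parity 0 q _ i≡2q   = inj₁ (divides q (trans i≡2q (ℤ.+-identityˡ (q * + 2))))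
  parity 1 q _ i≡2q+1 = inj₂ (divides (q + 1ℤ) (trans (cong (λ x → x + 1ℤ) i≡2q+1) (solve (q List.∷ List.[]))))
  parity (suc (suc _)) _ (s≤s (s≤s ())) _

¬even-1 : ¬ Even 1ℤ
¬even-1 2∣1 with ℕ.∣1⇒≡1 (∣⇒∣ᵤ 2∣1)
... | ()

even-2*i : ∀ i → Even (+ 2 * i)
even-2*i i = ∣m⇒∣m*n i ∣-refl

even-square⇒even : ∀ i → Even (i * i) → Even i
even-square⇒even i even-i² =
  Sum.[ (λ even-i → even-i) , (λ even-i+1 → ⊥-elim (¬even-1 (odd-square even-i+1))) ]′ (even-or-odd i)
  where
  consecutive-squares : ∀ i → (i + 1ℤ) * (i + 1ℤ) - i * i ≡ + 2 * i + 1ℤ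
  consecutive-squares = solve-∀
  odd-square : Even (i + 1ℤ) → Even 1ℤ
  odd-square even-i+1 = ∣m+n∣m⇒∣n
    (subst Even (consecutive-squares i) (∣m∣n⇒∣m-n (∣m⇒∣m*n (i + 1ℤ) even-i+1) even-i²)) (even-2*i i)

odd+odd⇒even : ∀ i j → Even (i + 1ℤ) → Even (j + 1ℤ) → Even (i + j)
odd+odd⇒even i j even-i+1 even-j+1 = subst Even (cancel i j) (∣m∣n⇒∣m-n (∣m∣n⇒∣m+n even-i+1 even-j+1) (∣-refl {+ 2}))
  where
  cancel : ∀ i j → i + 1ℤ + (j + 1ℤ) - + 2 ≡ i + j
  cancel = solve-∀

odd*i-even⇒i-even : ∀ g i → Even (g + 1ℤ) → Even (g * i) → Even i
odd*i-even⇒i-even g i even-g+1 even-gi = subst Even (cancel g i) (∣m∣n⇒∣m-n (∣m⇒∣m*n i even-g+1) even-gi)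
  where
  cancel : ∀ g i → (g + 1ℤ) * i - g * i ≡ i
  cancel = solve-∀

average : ∀ s t → Even (s + t) → ∃[ a ] ∃[ b ] s ≡ a - b × t ≡ a + b
average s t (divides a s+t≡2a) = a , a - s , solve (a List.∷ s List.∷ List.[]) , (begin
  t               ≡⟨ solve (s List.∷ t List.∷ List.[]) ⟩
  (s + t) - s     ≡⟨ cong (λ x → x - s) s+t≡2a ⟩
  a * + 2 - s     ≡⟨ solve (a List.∷ s List.∷ List.[]) ⟩
  a + (a - s)     ∎)

-- Quaternion rotation matrices

-- The rows of the matrix R(q) of v ↦ q v q̄ for the quaternion q = w + xi + yj + zk.
row₁ row₂ row₃ : ℤ → ℤ → ℤ → ℤ → Vecℤ 3
row₁ w x y z = ⟨ w * w + x * x - y * y - z * z , + 2 * (x * y - w * z) , + 2 * (w * y + x * z) ⟩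
row₂ w x y z = ⟨ + 2 * (x * y + w * z) , w * w - x * x + y * y - z * z , + 2 * (y * z - w * x) ⟩
row₃ w x y z = ⟨ + 2 * (x * z - w * y) , + 2 * (y * z + w * x) , w * w - x * x - y * y + z * z ⟩

-- Exposes the coordinates, so that the ring solver sees a polynomial goal.
dot-expand : ∀ {a b c d e f r : ℤ} (u v : Vecℤ 3) → u ≡ ⟨ a , b , c ⟩ → v ≡ ⟨ d , e , f ⟩ →
  a * d + (b * e + (c * f + 0ℤ)) ≡ r → dot u v ≡ r
dot-expand _ _ refl refl eq = eq

rows-weakOrthoregular : ∀ w x y z → WeakOrthoregular (row₁ w x y z) (row₂ w x y z) (row₃ w x y z)
rows-weakOrthoregular w x y z = record
  { u⟂v = dot-expand r₁ r₂ refl refl (solve vs)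
  ; u⟂w = dot-expand r₁ r₃ refl refl (solve vs)
  ; v⟂w = dot-expand r₂ r₃ refl refl (solve vs)
  ; ∣v∣≡∣u∣ = trans ∣r₂∣² (sym ∣r₁∣²)
  ; ∣w∣≡∣u∣ = trans ∣r₃∣² (sym ∣r₁∣²)
  }
  where
  r₁ = row₁ w x y z
  r₂ = row₂ w x y z
  r₃ = row₃ w x y z
  vs = w List.∷ x List.∷ y List.∷ z List.∷ List.[]
  ∣r₁∣² : normSq r₁ ≡ (w * w + x * x + y * y + z * z) * (w * w + x * x + y * y + z * z)
  ∣r₁∣² = dot-expand r₁ r₁ refl refl (solve vs)
  ∣r₂∣² : normSq r₂ ≡ (w * w + x * x + y * y + z * z) * (w * w + x * x + y * y + z * z)
  ∣r₂∣² = dot-expand r₂ r₂ refl refl (solve vs)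
  ∣r₃∣² : normSq r₃ ≡ (w * w + x * x + y * y + z * z) * (w * w + x * x + y * y + z * z)
  ∣r₃∣² = dot-expand r₃ r₃ refl refl (solve vs)

completion-row₁ : ∀ w x y z → Completion (row₁ w x y z)
completion-row₁ w x y z = row₂ w x y z , row₃ w x y z , rows-weakOrthoregular w x y z

completion-row₂ : ∀ w x y z → Completion (row₂ w x y z)
completion-row₂ w x y z = row₁ w x y z , row₃ w x y z , weakOrthoregular-swap₁₂ (rows-weakOrthoregular w x y z)

completion-row₃ : ∀ w x y z → Completion (row₃ w x y z)
completion-row₃ w x y z =
  row₁ w x y z , row₂ w x y z , weakOrthoregular-swap₁₂ (weakOrthoregular-swap₂₃ (rows-weakOrthoregular w x y z))

-- R((1 + u) q) = R(1 + u) R(q), and the first row of R(1 + u) is 2e₁, 2e₃, −2e₂ for u = i, j, k.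
row₁-[1+i]q : ∀ a b c d → row₁ (a - b) (a + b) (c - d) (c + d) ≡ + 2 *ₗ row₁ a b c d
row₁-[1+i]q a b c d = ⟨,,⟩-cong (solve vs) (solve vs) (solve vs)
  where vs = a List.∷ b List.∷ c List.∷ d List.∷ List.[]

row₁-[1+j]q : ∀ a b c d → row₁ (a - c) (d + b) (a + c) (d - b) ≡ + 2 *ₗ row₃ a b c d
row₁-[1+j]q a b c d = ⟨,,⟩-cong (solve vs) (solve vs) (solve vs)
  where vs = a List.∷ b List.∷ c List.∷ d List.∷ List.[]

row₁-[1+k]q : ∀ a b c d → row₁ (a - d) (b - c) (b + c) (a + d) ≡ + 2 *ₗ - 1ℤ *ₗ row₂ a b c d
row₁-[1+k]q a b c d = ⟨,,⟩-cong (solve vs) (solve vs) (solve vs)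
  where vs = a List.∷ b List.∷ c List.∷ d List.∷ List.[]

EvenPairing : ℤ → ℤ → ℤ → ℤ → Set
EvenPairing w x y z = (Even (w + x) × Even (y + z)) ⊎ (Even (w + y) × Even (z + x)) ⊎ (Even (w + z) × Even (x + y))

even-norm⇒pairing : ∀ w x y z → Even (w * w + x * x + y * y + z * z) → EvenPairing w x y z
even-norm⇒pairing w x y z even-N = pairing (even-or-odd (w + x)) (even-or-odd (w + y))
  where
  vs = w List.∷ x List.∷ y List.∷ z List.∷ List.[]
  square-of-sum : ∀ w x y z → w * w + x * x + y * y + z * z + + 2 * (w * x + w * y + w * z + x * y + x * z + y * z)
    ≡ (w + x + y + z) * (w + x + y + z)
  square-of-sum = solve-∀
  even-sum : Even (w + x + y + z)
  even-sum = even-square⇒even _ (subst Even (square-of-sum w x y z) (∣m∣n⇒∣m+n even-N (even-2*i _)))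
  complement : ∀ s t → w + x + y + z ≡ s + t → Even s → Even t
  complement s t sum≡ even-s = ∣m+n∣m⇒∣n (subst Even sum≡ even-sum) even-s
  third : ∀ w x y z → w + x + y + z - (w + x + (w + y)) + + 2 * w ≡ w + z
  third = solve-∀
  pairing : Even (w + x) ⊎ Even (w + x + 1ℤ) → Even (w + y) ⊎ Even (w + y + 1ℤ) → EvenPairing w x y z
  pairing (inj₁ even-w+x) _ = inj₁ (even-w+x , complement (w + x) (y + z) (solve vs) even-w+x)
  pairing (inj₂ _) (inj₁ even-w+y) = inj₂ (inj₁ (even-w+y , complement (w + y) (z + x) (solve vs) even-w+y))
  pairing (inj₂ odd-w+x) (inj₂ odd-w+y) = inj₂ (inj₂ (even-w+z , complement (w + z) (x + y) (solve vs) even-w+z))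
    where
    even-w+z : Even (w + z)
    even-w+z = subst Even (third w x y z)
      (∣m∣n⇒∣m+n (∣m∣n⇒∣m-n even-sum (odd+odd⇒even (w + x) (w + y) odd-w+x odd-w+y)) (even-2*i w))

halve-row₁ : ∀ w x y z → EvenPairing w x y z → ∃[ u ] Completion u × row₁ w x y z ≡ + 2 *ₗ u
halve-row₁ w x y z (inj₁ (even-w+x , even-y+z)) with average w x even-w+x | average y z even-y+z
... | a , b , refl , refl | c , d , refl , refl = row₁ a b c d , completion-row₁ a b c d , row₁-[1+i]q a b c d
halve-row₁ w x y z (inj₂ (inj₁ (even-w+y , even-z+x))) with average w y even-w+y | average z x even-z+x
... | a , c , refl , refl | d , b , refl , refl = row₃ a b c d , completion-row₃ a b c d , row₁-[1+j]q a b c d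
halve-row₁ w x y z (inj₂ (inj₂ (even-w+z , even-x+y))) with average w z even-w+z | average x y even-x+y
... | a , d , refl , refl | b , c , refl , refl =
  - 1ℤ *ₗ row₂ a b c d , completion-*ₗ (- 1ℤ) (completion-row₂ a b c d) , row₁-[1+k]q a b c d

halved-completion : ∀ k u v → + 2 *ₗ k *ₗ u ≡ + 2 *ₗ v → Completion u → Completion v
halved-completion k u v 2ku≡2v u-completion =
  subst Completion (*ₗ-cancelˡ (+ 2) (k *ₗ u) v 2ku≡2v) (completion-*ₗ k u-completion)

completion-of-scaled-row : ∀ g w x y z D v → g *ₗ row₁ w x y z ≡ + 2 *ₗ v →
  g * (w * w + x * x + y * y + z * z) ≡ + 2 * D → Completion v
completion-of-scaled-row g w x y z D v gr≡2v gN≡2D = by-parity (even-or-odd g)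
  where
  r = row₁ w x y z
  by-parity : Even g ⊎ Even (g + 1ℤ) → Completion v
  by-parity (inj₁ (divides h g≡2h)) = halved-completion h r v (begin
    + 2 *ₗ h *ₗ r   ≡⟨ *ₗ-comm (+ 2) h r ⟩
    h *ₗ + 2 *ₗ r   ≡⟨ *ₗ-assoc h (+ 2) r ⟨
    (h * + 2) *ₗ r  ≡⟨ cong (_*ₗ r) g≡2h ⟨
    g *ₗ r          ≡⟨ gr≡2v ⟩
    + 2 *ₗ v        ∎) (completion-row₁ w x y z)
  by-parity (inj₂ even-g+1) = odd (halve-row₁ w x y z (even-norm⇒pairing w x y z
    (odd*i-even⇒i-even g (w * w + x * x + y * y + z * z) even-g+1 (divides D (trans gN≡2D (ℤ.*-comm (+ 2) D))))))
    where
    odd : ∃[ u ] Completion u × r ≡ + 2 *ₗ u → Completion v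
    odd (u , u-completion , r≡2u) = halved-completion g u v (begin
      + 2 *ₗ g *ₗ u  ≡⟨ *ₗ-comm (+ 2) g u ⟩
      g *ₗ + 2 *ₗ u  ≡⟨ cong (g *ₗ_) r≡2u ⟨
      g *ₗ r         ≡⟨ gr≡2v ⟩
      + 2 *ₗ v       ∎) u-completion

-- Splitting a sum of two squares in the Gaussian integers

-- x + iy = g α β̄, p = g |α|² and q = g |β|², for the Gaussian integers α = a₀ + a₁ i and β = b₀ + b₁ i.
record GaussianSplitting (p q x y : ℤ) : Set where
  constructor splitting
  field
    g a₀ a₁ b₀ b₁ : ℤ
    p≡ : p ≡ g * (a₀ * a₀ + a₁ * a₁)
    q≡ : q ≡ g * (b₀ * b₀ + b₁ * b₁)
    x≡ : x ≡ g * (a₀ * b₀ + a₁ * b₁)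
    y≡ : y ≡ g * (a₁ * b₀ - a₀ * b₁)

splitting-cong : ∀ {p q q′ x x′ y y′} → q ≡ q′ → x ≡ x′ → y ≡ y′ →
  GaussianSplitting p q x y → GaussianSplitting p q′ x′ y′
splitting-cong refl refl refl s = s

splitting-zero : ∀ q {x y} → x * x + y * y ≡ 0ℤ → GaussianSplitting 0ℤ (+ q) x y
splitting-zero q {x} {y} x²+y²≡0
  with normSq≡0⇒≡zeroVec (x ∷ y ∷ []) (trans (cong (λ t → x * x + t) (ℤ.+-identityʳ (y * y))) x²+y²≡0)
... | refl = splitting (+ q) 0ℤ 0ℤ 1ℤ 0ℤ
  (sym (ℤ.*-zeroʳ (+ q))) (sym (ℤ.*-identityʳ (+ q))) (sym (ℤ.*-zeroʳ (+ q))) (sym (ℤ.*-zeroʳ (+ q)))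

splitting-swap : ∀ {p q x y} → GaussianSplitting q p x (- y) → GaussianSplitting p q x y
splitting-swap {y = y} (splitting g a₀ a₁ b₀ b₁ q≡ p≡ x≡ -y≡) = splitting g b₀ b₁ a₀ a₁ p≡ q≡
  (trans x≡ (swap-x g a₀ a₁ b₀ b₁))
  (trans (sym (ℤ.neg-involutive y)) (trans (cong (λ t → - t) -y≡) (swap-y g a₀ a₁ b₀ b₁)))
  where
  swap-x : ∀ g a₀ a₁ b₀ b₁ → g * (a₀ * b₀ + a₁ * b₁) ≡ g * (b₀ * a₀ + b₁ * a₁)
  swap-x = solve-∀
  swap-y : ∀ g a₀ a₁ b₀ b₁ → - (g * (a₁ * b₀ - a₀ * b₁)) ≡ g * (b₁ * a₀ - b₀ * a₁)
  swap-y = solve-∀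

-- β ↦ β + (m₁ − m₂ i) α, which moves x + iy by (m₁ + m₂ i) p
splitting-shift : ∀ {p q x y} m₁ m₂ → GaussianSplitting p q x y →
  GaussianSplitting p (q + + 2 * (m₁ * x + m₂ * y) + (m₁ * m₁ + m₂ * m₂) * p) (x + m₁ * p) (y + m₂ * p)
splitting-shift m₁ m₂ (splitting g a₀ a₁ b₀ b₁ refl refl refl refl) =
  splitting g a₀ a₁ (b₀ + m₁ * a₀ + m₂ * a₁) (b₁ + m₁ * a₁ - m₂ * a₀) refl (solve vs) (solve vs) (solve vs)
  where vs = g List.∷ a₀ List.∷ a₁ List.∷ b₀ List.∷ b₁ List.∷ m₁ List.∷ m₂ List.∷ List.[]

nearest-multiple : ∀ x p .{{_ : ℕ.NonZero p}} → ∃[ m ] 2 ℕ.* ∣ x - m * + p ∣ ℕ.≤ p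
nearest-multiple x p = nearest (x ℤ.%ℕ p) (x ℤ./ℕ p) (ℤ.n%ℕd<d x p) (ℤ.a≡a%ℕn+[a/ℕn]*n x p)
  where
  rounded-down : ∀ r q P → r + q * P - q * P ≡ r
  rounded-down = solve-∀
  rounded-up : ∀ r q P → r + q * P - (q + 1ℤ) * P ≡ r - P
  rounded-up = solve-∀
  nearest : ∀ r q → r ℕ.< p → x ≡ + r + q * + p → ∃[ m ] 2 ℕ.* ∣ x - m * + p ∣ ℕ.≤ p
  nearest r q r<p x≡r+qp with 2 ℕ.* r ℕ.≤? p
  ... | yes 2r≤p = q , subst (λ k → 2 ℕ.* k ℕ.≤ p) (sym (cong ∣_∣ x-qp≡r)) 2r≤p
    where
    x-qp≡r : x - q * + p ≡ + r
    x-qp≡r = trans (cong (λ t → t - q * + p) x≡r+qp) (rounded-down (+ r) q (+ p))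
  ... | no 2r≰p = q + 1ℤ , subst (λ k → 2 ℕ.* k ℕ.≤ p) (sym ∣x-[q+1]p∣≡p-r) 2[p-r]≤p
    where
    ∣x-[q+1]p∣≡p-r : ∣ x - (q + 1ℤ) * + p ∣ ≡ p ℕ.∸ r
    ∣x-[q+1]p∣≡p-r = begin
      ∣ x - (q + 1ℤ) * + p ∣  ≡⟨ cong (λ t → ∣ t - (q + 1ℤ) * + p ∣) x≡r+qp ⟩
      ∣ + r + q * + p - (q + 1ℤ) * + p ∣ ≡⟨ cong ∣_∣ (rounded-up (+ r) q (+ p)) ⟩
      ∣ + r - + p ∣            ≡⟨ cong ∣_∣ (ℤ.[+m]-[+n]≡m⊖n r p) ⟩
      ∣ r ℤ.⊖ p ∣              ≡⟨ ℤ.∣⊖∣-≤ (ℕ.<⇒≤ r<p) ⟩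
      p ℕ.∸ r                  ∎
    2[p-r]≤p : 2 ℕ.* (p ℕ.∸ r) ℕ.≤ p
    2[p-r]≤p = ℕ.≤-trans (ℕ.≤-reflexive (ℕ.*-distribˡ-∸ 2 p r))
      (ℕ.≤-trans (ℕ.∸-monoʳ-≤ (2 ℕ.* p) (ℕ.<⇒≤ (ℕ.≰⇒> 2r≰p)))
        (ℕ.≤-reflexive (trans (ℕ.m+n∸m≡n p (p ℕ.+ 0)) (ℕ.+-identityʳ p))))

-- 4 p q = (2k₁)² + (2k₂)² ≤ 2 p²
descent-bound : ∀ p q k₁ k₂ .{{_ : ℕ.NonZero p}} → p ℕ.* q ≡ k₁ ℕ.* k₁ ℕ.+ k₂ ℕ.* k₂ →
  2 ℕ.* k₁ ℕ.≤ p → 2 ℕ.* k₂ ℕ.≤ p → 2 ℕ.* q ℕ.≤ p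
descent-bound p q k₁ k₂ pq≡ 2k₁≤p 2k₂≤p = ℕ.*-cancelʳ-≤ (2 ℕ.* q) p (2 ℕ.* p) {{ℕ.m*n≢0 2 p}}
  (ℕ.≤-trans (ℕ.≤-reflexive (trans (scale p q) (trans (cong (4 ℕ.*_) pq≡) (double k₁ k₂))))
    (ℕ.≤-trans (ℕ.+-mono-≤ (ℕ.*-mono-≤ 2k₁≤p 2k₁≤p) (ℕ.*-mono-≤ 2k₂≤p 2k₂≤p)) (ℕ.≤-reflexive (twice p))))
  where
  scale : ∀ p q → 2 ℕ.* q ℕ.* (2 ℕ.* p) ≡ 4 ℕ.* (p ℕ.* q)
  scale = ℕ-Solver.solve-∀
  double : ∀ k₁ k₂ → 4 ℕ.* (k₁ ℕ.* k₁ ℕ.+ k₂ ℕ.* k₂) ≡ 2 ℕ.* k₁ ℕ.* (2 ℕ.* k₁) ℕ.+ 2 ℕ.* k₂ ℕ.* (2 ℕ.* k₂)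
  double = ℕ-Solver.solve-∀
  twice : ∀ p → p ℕ.* p ℕ.+ p ℕ.* p ≡ p ℕ.* (2 ℕ.* p)
  twice = ℕ-Solver.solve-∀

+[1+n]*i≡+⇒i≡+ : ∀ n i {m} → + suc n * i ≡ + m → ∃[ k ] i ≡ + k
+[1+n]*i≡+⇒i≡+ n (+ k) _ = k , refl
+[1+n]*i≡+⇒i≡+ n -[1+ _ ] ()

x²+[-y]²≡x²+y² : ∀ x y → x * x + - y * - y ≡ x * x + y * y
x²+[-y]²≡x²+y² = solve-∀

-- x + iy reduced modulo p = 1 + n to x′ + iy′ with |x′|, |y′| ≤ p/2, so that x′² + y′² = p q′ with q′ ≤ p/2.
record Reduction (n q : ℕ) (x y : ℤ) : Set where
  field
    m₁ m₂ : ℤ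
    q′ : ℕ
    2q′≤p : 2 ℕ.* q′ ℕ.≤ suc n
    x′²+y′²≡pq′ : (x - m₁ * + suc n) * (x - m₁ * + suc n) + (y - m₂ * + suc n) * (y - m₂ * + suc n) ≡ + suc n * + q′
    q≡ : + q ≡ + q′ + + 2 * (m₁ * (x - m₁ * + suc n) + m₂ * (y - m₂ * + suc n)) + (m₁ * m₁ + m₂ * m₂) * + suc n

reduction : ∀ n q x y → x * x + y * y ≡ + suc n * + q → Reduction n q x y
reduction n q x y x²+y²≡pq = reduce-mod-p (nearest-multiple x p) (nearest-multiple y p)
  where
  p = suc n
  shifted-norm : ∀ P q x y m₁ m₂ → P * (q - + 2 * (m₁ * x + m₂ * y) + (m₁ * m₁ + m₂ * m₂) * P)
    ≡ (x - m₁ * P) * (x - m₁ * P) + (y - m₂ * P) * (y - m₂ * P) + (P * q - (x * x + y * y))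
  shifted-norm = solve-∀
  unshift : ∀ P q x y m₁ m₂ → q ≡ q - + 2 * (m₁ * x + m₂ * y) + (m₁ * m₁ + m₂ * m₂) * P
    + + 2 * (m₁ * (x - m₁ * P) + m₂ * (y - m₂ * P)) + (m₁ * m₁ + m₂ * m₂) * P
  unshift = solve-∀
  reduce-mod-p : ∃[ m ] 2 ℕ.* ∣ x - m * + p ∣ ℕ.≤ p → ∃[ m ] 2 ℕ.* ∣ y - m * + p ∣ ℕ.≤ p → Reduction n q x y
  reduce-mod-p (m₁ , 2∣x′∣≤p) (m₂ , 2∣y′∣≤p) = record
    { m₁ = m₁ ; m₂ = m₂ ; q′ = q′
    ; 2q′≤p = descent-bound p q′ ∣ x′ ∣ ∣ y′ ∣ pq′≡ 2∣x′∣≤p 2∣y′∣≤p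
    ; x′²+y′²≡pq′ = trans (sym pQ≡x′²+y′²) (cong (+ p *_) Q≡q′)
    ; q≡ = trans (unshift (+ p) (+ q) x y m₁ m₂) (cong (λ t → t + + 2 * (m₁ * x′ + m₂ * y′) + (m₁ * m₁ + m₂ * m₂) * + p) Q≡q′)
    }
    where
    x′ = x - m₁ * + p
    y′ = y - m₂ * + p
    Q = + q - + 2 * (m₁ * x + m₂ * y) + (m₁ * m₁ + m₂ * m₂) * + p
    pQ≡x′²+y′² : + p * Q ≡ x′ * x′ + y′ * y′
    pQ≡x′²+y′² = begin
      + p * Q                                             ≡⟨ shifted-norm (+ p) (+ q) x y m₁ m₂ ⟩
      x′ * x′ + y′ * y′ + (+ p * + q - (x * x + y * y))   ≡⟨ cong (λ t → x′ * x′ + y′ * y′ + (+ p * + q - t)) x²+y²≡pq ⟩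
      x′ * x′ + y′ * y′ + (+ p * + q - + p * + q)         ≡⟨ cong (λ t → x′ * x′ + y′ * y′ + t) (ℤ.+-inverseʳ (+ p * + q)) ⟩
      x′ * x′ + y′ * y′ + 0ℤ                              ≡⟨ ℤ.+-identityʳ (x′ * x′ + y′ * y′) ⟩
      x′ * x′ + y′ * y′                                   ∎
    pQ≡+ : + p * Q ≡ + (∣ x′ ∣ ℕ.* ∣ x′ ∣ ℕ.+ ∣ y′ ∣ ℕ.* ∣ y′ ∣)
    pQ≡+ = trans pQ≡x′²+y′² (cong₂ _+_ (i*i≡+∣i∣*∣i∣ x′) (i*i≡+∣i∣*∣i∣ y′))
    q′ = proj₁ (+[1+n]*i≡+⇒i≡+ n Q pQ≡+)
    Q≡q′ : Q ≡ + q′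
    Q≡q′ = proj₂ (+[1+n]*i≡+⇒i≡+ n Q pQ≡+)
    pq′≡ : p ℕ.* q′ ≡ ∣ x′ ∣ ℕ.* ∣ x′ ∣ ℕ.+ ∣ y′ ∣ ℕ.* ∣ y′ ∣
    pq′≡ = ℤ.+-injective (trans (ℤ.pos-* p q′) (trans (cong (+ p *_) (sym Q≡q′)) pQ≡+))

splitting≤ : ∀ p q x y → Acc ℕ._<_ p → p ℕ.≤ q → x * x + y * y ≡ + p * + q → GaussianSplitting (+ p) (+ q) x y
splitting≤ zero    q x y _            _ x²+y²≡0  = splitting-zero q x²+y²≡0
splitting≤ (suc n) q x y (acc smaller) _ x²+y²≡pq = descend (reduction n q x y x²+y²≡pq)
  where
  p = suc n
  undo : ∀ x m P → x ≡ x - m * P + m * P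
  undo = solve-∀
  -- descent: the reduced problem, with the roles of p and q′ exchanged, has first argument q′ < p
  descend : Reduction n q x y → GaussianSplitting (+ p) (+ q) x y
  descend r = splitting-cong (sym q≡) (sym (undo x m₁ (+ p))) (sym (undo y m₂ (+ p)))
    (splitting-shift m₁ m₂ (splitting-swap (splitting≤ q′ p x′ (- y′) (smaller q′<p) (ℕ.<⇒≤ q′<p)
      (trans (x²+[-y]²≡x²+y² x′ y′) (trans x′²+y′²≡pq′ (ℤ.*-comm (+ p) (+ q′)))))))
    where
    open Reduction r
    x′ = x - m₁ * + p
    y′ = y - m₂ * + p
    q′<p : q′ ℕ.< p
    q′<p = 2*m≤n⇒m<n 2q′≤p

gaussian-splitting : ∀ p q x y → x * x + y * y ≡ + p * + q → GaussianSplitting (+ p) (+ q) x y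
gaussian-splitting p q x y x²+y²≡pq with p ℕ.≤? q
... | yes p≤q = splitting≤ p q x y (<-wellFounded p) p≤q x²+y²≡pq
... | no  p≰q = splitting-swap (splitting≤ q p x (- y) (<-wellFounded q) (ℕ.<⇒≤ (ℕ.≰⇒> p≰q))
  (trans (x²+[-y]²≡x²+y² x y) (trans x²+y²≡pq (ℤ.*-comm (+ p) (+ q)))))

-- Completing a vector of integral length

-- With p = D + a and q = D − a the quaternion a₀ + a₁ i + b₀ j + b₁ k has g·row₁ = 2 (a, b, c).
completion-from-splitting : ∀ a b c D → GaussianSplitting (D + a) (D - a) c b → Completion ⟨ a , b , c ⟩
completion-from-splitting a b c D (splitting g a₀ a₁ b₀ b₁ p≡ q≡ c≡ b≡) =
  completion-of-scaled-row g a₀ a₁ b₀ b₁ D ⟨ a , b , c ⟩ (⟨,,⟩-cong first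
    (trans (double-inside g _) (cong (+ 2 *_) (sym b≡))) (trans (double-inside g _) (cong (+ 2 *_) (sym c≡)))) norm
  where
  double-inside : ∀ g s → g * (+ 2 * s) ≡ + 2 * (g * s)
  double-inside = solve-∀
  vs = g List.∷ a₀ List.∷ a₁ List.∷ b₀ List.∷ b₁ List.∷ a List.∷ D List.∷ List.[]
  first : g * (a₀ * a₀ + a₁ * a₁ - b₀ * b₀ - b₁ * b₁) ≡ + 2 * a
  first = begin
    g * (a₀ * a₀ + a₁ * a₁ - b₀ * b₀ - b₁ * b₁)        ≡⟨ solve vs ⟩
    g * (a₀ * a₀ + a₁ * a₁) - g * (b₀ * b₀ + b₁ * b₁)  ≡⟨ cong₂ _-_ p≡ q≡ ⟨
    (D + a) - (D - a)                                  ≡⟨ solve vs ⟩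
    + 2 * a                                            ∎
  norm : g * (a₀ * a₀ + a₁ * a₁ + b₀ * b₀ + b₁ * b₁) ≡ + 2 * D
  norm = begin
    g * (a₀ * a₀ + a₁ * a₁ + b₀ * b₀ + b₁ * b₁)        ≡⟨ solve vs ⟩
    g * (a₀ * a₀ + a₁ * a₁) + g * (b₀ * b₀ + b₁ * b₁)  ≡⟨ cong₂ _+_ p≡ q≡ ⟨
    (D + a) + (D - a)                                  ≡⟨ solve vs ⟩
    + 2 * D                                            ∎

c²+b²≡[D+a][D-a] : ∀ a b c D → a * a + (b * b + (c * c + 0ℤ)) ≡ D * D → c * c + b * b ≡ (D + a) * (D - a)
c²+b²≡[D+a][D-a] a b c D a²+b²+c²≡D² = begin
  c * c + b * b                          ≡⟨ solve vs ⟩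
  a * a + (b * b + (c * c + 0ℤ)) - a * a ≡⟨ cong (λ t → t - a * a) a²+b²+c²≡D² ⟩
  D * D - a * a                          ≡⟨ solve vs ⟩
  (D + a) * (D - a)                      ∎
  where vs = a List.∷ b List.∷ c List.∷ D List.∷ List.[]

d±a-natural : ∀ a d → ∣ a ∣ ℕ.≤ d → ∃[ p ] ∃[ q ] + p ≡ + d + a × + q ≡ + d - a
d±a-natural (+ n)    d n≤d  = d ℕ.+ n , d ℕ.∸ n , refl , sym (trans (ℤ.m-n≡m⊖n d n) (ℤ.⊖-≥ n≤d))
d±a-natural -[1+ n ] d 1+n≤d = d ℕ.∸ suc n , d ℕ.+ suc n , sym (ℤ.⊖-≥ 1+n≤d) , refl

completion-of-square-norm : ∀ a b c d → normSq ⟨ a , b , c ⟩ ≡ + d * + d → Completion ⟨ a , b , c ⟩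
completion-of-square-norm a b c d v²≡d² = split (d±a-natural a d ∣a∣≤d)
  where
  ∣a∣≤d : ∣ a ∣ ℕ.≤ d
  ∣a∣≤d = m*m≤n*n⇒m≤n (ℕ.≤-trans (ℕ.m≤m+n _ _) (ℕ.≤-reflexive
    (ℤ.+-injective (trans (sym (normSq≡+normSqℕ ⟨ a , b , c ⟩)) (trans v²≡d² (sym (ℤ.pos-* d d)))))))
  split : ∃[ p ] ∃[ q ] + p ≡ + d + a × + q ≡ + d - a → Completion ⟨ a , b , c ⟩
  split (p , q , p≡d+a , q≡d-a) = completion-from-splitting a b c (+ d)
    (subst₂ (λ P Q → GaussianSplitting P Q c b) p≡d+a q≡d-a (gaussian-splitting p q c b
      (trans (c²+b²≡[D+a][D-a] a b c (+ d) v²≡d²) (cong₂ _*_ (sym p≡d+a) (sym q≡d-a)))))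

orthoregular-completion : ∀ v → ¬ v ≡ zeroVec 3 → NormIsInteger v → ∃[ w₁ ] ∃[ w₂ ] Orthoregular (triple v w₁ w₂)
orthoregular-completion ⟨ a , b , c ⟩ v≢0 (d , v²≡d²) = orthoregular (completion-of-square-norm a b c d v²≡d²)
  where
  orthoregular : Completion ⟨ a , b , c ⟩ → ∃[ w₁ ] ∃[ w₂ ] Orthoregular (triple ⟨ a , b , c ⟩ w₁ w₂)
  orthoregular (w₁ , w₂ , W) = w₁ , w₂ , weakOrthoregular⇒orthoregular W (v≢0 ∘ normSq≡0⇒≡zeroVec _)

extends-to-3 : ∀ (S : System 3 1) → Orthoregular S → LengthInℤ S → ExtendsTo S 3
extends-to-3 S (_ , _ , ∣S∣≢0) integral = extend (orthoregular-completion (S zero) (∣S∣≢0 zero ∘ cong normSq) (integral zero))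
  where
  extend : ∃[ w₁ ] ∃[ w₂ ] Orthoregular (triple (S zero) w₁ w₂) → ExtendsTo S 3
  extend (w₁ , w₂ , ortho) = triple (S zero) w₁ w₂ , ortho , λ { zero → zero , refl }

E≡3 : ∀ (S : System 3 1) → Orthoregular S → LengthInℤ S → IsE S 3
E≡3 S ortho integral = extends-to-3 S ortho integral , λ _ (T , T-ortho , _) → orthoregular-size≤3 T T-ortho

mainTheorem3 : (∀ (v : Vecℤ 3) → ¬ (v ≡ zeroVec 3) →
                 ((∃[ w₁ ] ∃[ w₂ ] Orthoregular (triple v w₁ w₂))
                  ⇔ NormIsInteger v))
               × IsEℤ 3 1 3
mainTheorem3 =
  (λ v v≢0 → mk⇔ (λ (w₁ , w₂ , ortho) → orthoregular-triple⇒normIsInteger v w₁ w₂ ortho)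
                 (orthoregular-completion v v≢0)) ,
  (e₁ , e₁-orthoregular , e₁-integral , E≡3 e₁ e₁-orthoregular e₁-integral) ,
  (λ S ortho integral _ (_ , maximal) → maximal 3 (extends-to-3 S ortho integral))
  where
  e₁ : System 3 1
  e₁ _ = ⟨ 1ℤ , 0ℤ , 0ℤ ⟩
  e₁-orthoregular : Orthoregular e₁
  e₁-orthoregular = single-orthoregular ⟨ 1ℤ , 0ℤ , 0ℤ ⟩ (λ ())
  e₁-integral : LengthInℤ e₁
  e₁-integral _ = 1 , refl
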